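{- Let $n\ge1$ and $m\in[n]$. Among the $321$-avoiding permutations $\pi$ of $[n]$, the following four sets are equinumerous, each having $C^{(m+1)}_{n-m}$ elements: (1) those in which the letter $1$ occurs at position $m$ or later; (2) those with first entry $\ge m$; (3) those in which the letter $n$ occurs at position $n+1-m$ or earlier (i.e., no later than the $m$th position from the end); (4) those with last entry $\le n+1-m$.
   Context: A permutation of $[n]$ is a word $\pi_1\cdots\pi_n$; it is $321$-avoiding if there are no positions $i<j<k$ with $\pi_i>\pi_j>\pi_k$. For integers $k\ge 1$ and $m\ge0$, $C^{(k)}_m=[x^m]C(x)^k=\frac{k}{2m+k}\binom{2m+k}{m}$, where $C(x)$ is the generating function of the Catalan numbers. -}

module Defs where

open import Data.Nat using (ℕ; zero; suc; _+_; _*_; _∸_; _≤_; _<_; _≤?_; _<?_)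
open import Data.Nat.Combinatorics using (_C_)
open import Data.Nat.DivMod using (_/_)
open import Data.Fin using (Fin; toℕ; fromℕ) renaming (zero to fz; suc to fs)
open import Data.Fin.Properties using (_≟_; all?; any?)
open import Data.Vec using (Vec; []; _∷_; lookup)
open import Data.List using (List; []; _∷_; concatMap; map; filter; length)
open import Data.List.Membership.Propositional using (_∈_)
open import Data.Product using (Σ; ∃; _×_; _,_)
open import Relation.Nullary using (Dec; ¬_; yes; no)
open import Relation.Nullary.Decidable using (_×-dec_; ¬?)
open import Relation.Unary using (Pred; Decidable)
open import Relation.Binary.PropositionalEquality using (_≡_)
open import Level using (0ℓ)

-- All words of length k over the alphabet Fin n (= [n], letter j+1 encoded by j).
words : (n k : ℕ) → List (Vec (Fin n) k)
words n zero = [] ∷ []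
words n (suc k) = concatMap (λ w → map (_∷ w) (Data.List.allFin n)) (words n k)
  where import Data.List

IsPerm : ∀ {n} → Vec (Fin n) n → Set
IsPerm {n} π = (j : Fin n) → Σ (Fin n) λ i → lookup π i ≡ j

isPerm? : ∀ {n} → Decidable (IsPerm {n})
isPerm? π = all? (λ j → any? (λ i → lookup π i ≟ j))

Has321 : ∀ {n} → Vec (Fin n) n → Set
Has321 {n} π = Σ (Fin n) λ i → Σ (Fin n) λ j → Σ (Fin n) λ k →
  (toℕ i < toℕ j) × (toℕ j < toℕ k) ×
  (toℕ (lookup π j) < toℕ (lookup π i)) × (toℕ (lookup π k) < toℕ (lookup π j))

has321? : ∀ {n} → Decidable (Has321 {n})
has321? π = any? λ i → any? λ j → any? λ k →
  (toℕ i <? toℕ j) ×-dec (toℕ _ <? toℕ _) ×-dec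
  (toℕ (lookup π j) <? toℕ (lookup π i)) ×-dec (toℕ (lookup π k) <? toℕ (lookup π j))

Avoids321 : ∀ {n} → Vec (Fin n) n → Set
Avoids321 π = ¬ Has321 π

Av321 : ∀ {n} → Vec (Fin n) n → Set
Av321 π = IsPerm π × Avoids321 π

av321? : ∀ {n} → Decidable (Av321 {n})
av321? π = isPerm? π ×-dec ¬? (has321? π)

count321 : (n : ℕ) (P : Pred (Vec (Fin n) n) 0ℓ) → Decidable P → ℕ
count321 n P P? = length (filter (λ π → av321? π ×-dec P? π) (words n n))

-- Value (1-based) of a letter and position (1-based) of an index.
val : ∀ {n} → Fin n → ℕ
val i = suc (toℕ i)

-- C^{(k)}_m = k/(2m+k) * binom(2m+k, m)   (exact division, k ≥ 1)
catK : (k m : ℕ) → ℕ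
catK zero m = zero
catK (suc k') m = (suc k' * ((suc k' + 2 * m) C m)) / (suc k' + 2 * m)

-- The four conditions, for permutations of [n] with n = suc n'  (1-based positions/values).
-- (1) letter 1 occurs at position ≥ m
Cond1 : ∀ {n'} → ℕ → Vec (Fin (suc n')) (suc n') → Set
Cond1 m π = Σ (Fin _) λ i → (lookup π i ≡ fz) × (m ≤ val i)

Cond2 : ∀ {n'} → ℕ → Vec (Fin (suc n')) (suc n') → Set
Cond2 m π = m ≤ val (lookup π fz)

Cond3 : ∀ {n'} → ℕ → Vec (Fin (suc n')) (suc n') → Set
Cond3 {n'} m π = Σ (Fin _) λ i → (lookup π i ≡ fromℕ n') × (val i ≤ suc (suc n') ∸ m)

Cond4 : ∀ {n'} → ℕ → Vec (Fin (suc n')) (suc n') → Set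
Cond4 {n'} m π = val (lookup π (fromℕ n')) ≤ suc (suc n') ∸ m

cond1? : ∀ {n'} m → Decidable (Cond1 {n'} m)
cond1? m π = any? λ i → (lookup π i ≟ fz) ×-dec (m ≤? val i)

cond2? : ∀ {n'} m → Decidable (Cond2 {n'} m)
cond2? m π = m ≤? val (lookup π fz)

cond3? : ∀ {n'} m → Decidable (Cond3 {n'} m)
cond3? {n'} m π = any? λ i → (lookup π i ≟ fromℕ n') ×-dec (val i ≤? suc (suc n') ∸ m)

cond4? : ∀ {n'} m → Decidable (Cond4 {n'} m)
cond4? {n'} m π = val (lookup π (fromℕ n')) ≤? suc (suc n') ∸ m

-- Build a 321-avoiding permutation from the front: given its standardised tail π, a first letter
-- v (counted from 0) keeps 321 avoided iff v ≤ label π, the least value of a letter of π exceeding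
-- a later letter (n if π is the identity).  Prepending 0 raises the label by one, any other v
-- becomes the new label.  So the number A(n,k) of 321-avoiders of [n] with label ≥ k satisfies
-- A(n+1,k+1) = A(n,k) + A(n+1,k+2), the recursion of the coefficients of C(x)^(k+1); and on [n+1]
-- the first letter (counted from 1) is ≥ m exactly as often as the label is, both counts being the
-- sum of (label π + 2 − m)⁺ over the tails π.  This counts (2); π ↦ π⁻¹ exchanges (1) and (2),
-- and reverse-complement exchanges (1) with (3) and (2) with (4).
module Submission where

open import Data.Nat
open import Data.Nat.Properties
open import Data.Nat.Combinatorics using (_C_; nC1≡n) renaming (nCk+nC[k+1]≡[n+1]C[k+1] to pascal)
open import Data.Nat.DivMod using (_/_; m*n/n≡m)
open import Data.Nat.Tactic.RingSolver using (solve-∀)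
open import Data.Nat.ListAction using (sum)
open import Data.Nat.ListAction.Properties using (sum-++)
open import Data.Bool using (Bool; true; false; _∧_)
open import Data.Fin using (Fin; toℕ; fromℕ; opposite; punchIn; punchOut) renaming (zero to fz; suc to fs)
open import Data.List using (List; []; _∷_; _++_; map; filter; length; concatMap; tabulate; allFin)
open import Data.List.Properties using (map-++)
import Data.Fin.Properties as Fin
open import Data.Vec as Vec using (Vec; []; _∷_; lookup)
import Data.Vec.Properties as Vec
import Data.List as List
open import Data.List.Membership.Propositional using (_∈_; find)
open import Data.List.Membership.Propositional.Properties
  using (∈-concatMap⁻; ∈-concatMap⁺; ∈-map⁻; ∈-map⁺; ∈-filter⁻; ∈-filter⁺; ∈-lookup; ∈-allFin)
open import Data.List.Relation.Unary.Any as Any using (Any; here; there)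
open import Data.List.Relation.Unary.Any.Properties using (lookup-index)
open import Data.List.Relation.Unary.All as All using (All)
open import Data.List.Relation.Unary.AllPairs using ([]; _∷_)
open import Data.List.Relation.Unary.Unique.Propositional using (Unique)
import Data.List.Relation.Unary.Unique.Propositional.Properties as Unique
open import Data.Empty using (⊥; ⊥-elim)
open import Data.Unit using (⊤; tt)
open import Data.Product using (Σ; ∃; _×_; _,_; proj₁; proj₂)
open import Function using (_∘_)
open import Relation.Nullary using (does; yes; no)
open import Relation.Nullary.Decidable using (_×-dec_; dec-false)
open import Relation.Unary using (Pred; Decidable)
open import Relation.Binary.PropositionalEquality
open import Level using (0ℓ)
open import Defs

-- Ballot k j is C^{(k)}_j: the recursion is C^{k+1} = C^k + x C^{k+2}, i.e. C = 1 + x C² times C^k.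
Ballot : ℕ → ℕ → ℕ
Ballot zero    zero    = 1
Ballot zero    (suc j) = 0
Ballot (suc k) zero    = 1
Ballot (suc k) (suc j) = Ballot k (suc j) + Ballot (suc (suc k)) j

[1+k]*[1+n]C[1+k]≡[1+n]*nCk : ∀ n k → suc k * (suc n C suc k) ≡ suc n * (n C k)
[1+k]*[1+n]C[1+k]≡[1+n]*nCk zero    zero    = refl
[1+k]*[1+n]C[1+k]≡[1+n]*nCk zero    (suc k) = *-zeroʳ (suc (suc k))
[1+k]*[1+n]C[1+k]≡[1+n]*nCk (suc n) zero    =
  trans (+-identityʳ _) (trans (nC1≡n (suc (suc n))) (sym (*-identityʳ (suc (suc n)))))
[1+k]*[1+n]C[1+k]≡[1+n]*nCk (suc n) (suc k) = begin
  suc (suc k) * (suc (suc n) C suc (suc k))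
    ≡⟨ cong (suc (suc k) *_) (pascal (suc n) (suc k)) ⟨
  suc (suc k) * (a + b)
    ≡⟨ split k a b ⟩
  suc k * a + a + suc (suc k) * b
    ≡⟨ cong₂ (λ x y → x + a + y) ([1+k]*[1+n]C[1+k]≡[1+n]*nCk n k) ([1+k]*[1+n]C[1+k]≡[1+n]*nCk n (suc k)) ⟩
  suc n * (n C k) + a + suc n * (n C suc k)
    ≡⟨ regroup n (n C k) (n C suc k) a ⟩
  suc n * (n C k + n C suc k) + a
    ≡⟨ cong (λ x → suc n * x + a) (pascal n k) ⟩
  suc n * a + a
    ≡⟨ +-comm (suc n * a) a ⟩
  suc (suc n) * a ∎
  where
  open ≡-Reasoning
  a = suc n C suc k
  b = suc n C suc (suc k)
  split : ∀ k a b → suc (suc k) * (a + b) ≡ suc k * a + a + suc (suc k) * b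
  split = solve-∀
  regroup : ∀ n x y z → suc n * x + z + suc n * y ≡ suc n * (x + y) + z
  regroup = solve-∀

[1+p]*[1+p+k]Ck≡[1+p+k]*[p+k]Ck : ∀ p k → suc p * ((suc p + k) C k) ≡ (suc p + k) * ((p + k) C k)
[1+p]*[1+p+k]Ck≡[1+p+k]*[p+k]Ck p zero    = cong (_* 1) (sym (+-identityʳ (suc p)))
[1+p]*[1+p+k]Ck≡[1+p+k]*[p+k]Ck p (suc k) = +-cancelˡ-≡ (suc k * X) _ _ (begin
  suc k * X + suc p * X       ≡⟨ *-distribʳ-+ X (suc k) (suc p) ⟨
  (suc k + suc p) * X         ≡⟨ cong (_* X) (+-comm (suc k) (suc p)) ⟩
  suc n * X                   ≡⟨ cong (suc n *_) (pascal n k) ⟨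
  suc n * (n C k + n C suc k) ≡⟨ *-distribˡ-+ (suc n) (n C k) (n C suc k) ⟩
  suc n * (n C k) + suc n * (n C suc k)
    ≡⟨ cong (_+ suc n * (n C suc k)) ([1+k]*[1+n]C[1+k]≡[1+n]*nCk n k) ⟨
  suc k * X + suc n * (n C suc k) ∎)
  where
  open ≡-Reasoning
  n X : ℕ
  n = p + suc k
  X = suc n C suc k

[1+j]*NC[1+j]≡[N∸j]*NCj : ∀ k j → suc j * ((k + 2 * suc j) C suc j) ≡ suc (suc (k + j)) * ((k + 2 * suc j) C j)
[1+j]*NC[1+j]≡[N∸j]*NCj k j = subst (λ N → suc j * (N C suc j) ≡ suc (suc (k + j)) * (N C j)) (sym (N≡2+k+j+j k j))
  (trans ([1+k]*[1+n]C[1+k]≡[1+n]*nCk (suc (k + j) + j) j) (sym ([1+p]*[1+p+k]Ck≡[1+p+k]*[p+k]Ck (suc (k + j)) j)))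
  where
  N≡2+k+j+j : ∀ k j → k + 2 * suc j ≡ suc (suc (k + j)) + j
  N≡2+k+j+j = solve-∀

Ballot-closed : ∀ k j → Ballot k j * (k + 2 * j) ≡ k * ((k + 2 * j) C j)
Ballot-closed zero    zero    = refl
Ballot-closed zero    (suc j) = refl
Ballot-closed (suc k) zero    =
  trans (*-identityˡ _) (trans (+-identityʳ (suc k)) (sym (*-identityʳ (suc k))))
Ballot-closed (suc k) (suc j) = *-cancelˡ-≡ _ _ N (begin
  N * ((d₁ + d₂) * suc N)           ≡⟨ distribute N d₁ d₂ ⟩
  suc N * (d₁ * N + d₂ * N)         ≡⟨ cong₂ (λ x y → suc N * (x + y)) (Ballot-closed k (suc j)) IH₂ ⟩
  suc N * (k * b + suc (suc k) * a) ≡⟨ +-cancelʳ-≡ _ _ _ balance ⟩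
  N * (suc k * (a + b))             ≡⟨ cong (λ z → N * (suc k * z)) (pascal N j) ⟩
  N * (suc k * (suc N C suc j))     ∎)
  where
  open ≡-Reasoning
  N a b d₁ d₂ : ℕ
  N = k + 2 * suc j
  a = N C j
  b = N C suc j
  d₁ = Ballot k (suc j)
  d₂ = Ballot (suc (suc k)) j
  instance
    N≢0 : NonZero N
    N≢0 = >-nonZero (≤-trans (s≤s z≤n) (m≤n+m (2 * suc j) k))
  [2+k]+2j≡k+2[1+j] : ∀ k j → suc (suc k) + 2 * j ≡ k + 2 * suc j
  [2+k]+2j≡k+2[1+j] = solve-∀
  IH₂ : d₂ * N ≡ suc (suc k) * a
  IH₂ = subst (λ z → d₂ * z ≡ suc (suc k) * (z C j)) ([2+k]+2j≡k+2[1+j] k j) (Ballot-closed (suc (suc k)) j)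
  distribute : ∀ N d₁ d₂ → N * ((d₁ + d₂) * suc N) ≡ suc N * (d₁ * N + d₂ * N)
  distribute = solve-∀
  identity : ∀ k j a b → suc (k + 2 * suc j) * (k * b + suc (suc k) * a) + 2 * (suc j * b)
                       ≡ (k + 2 * suc j) * (suc k * (a + b)) + 2 * (suc (suc (k + j)) * a)
  identity = solve-∀
  balance : suc N * (k * b + suc (suc k) * a) + 2 * (suc (suc (k + j)) * a)
          ≡ N * (suc k * (a + b)) + 2 * (suc (suc (k + j)) * a)
  balance = trans (cong (λ z → suc N * (k * b + suc (suc k) * a) + 2 * z) (sym ([1+j]*NC[1+j]≡[N∸j]*NCj k j))) (identity k j a b)

Ballot≡catK : ∀ k j → Ballot (suc k) j ≡ catK (suc k) j
Ballot≡catK k j = begin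
  Ballot (suc k) j                                     ≡⟨ m*n/n≡m (Ballot (suc k) j) (suc k + 2 * j) ⟨
  Ballot (suc k) j * (suc k + 2 * j) / (suc k + 2 * j) ≡⟨ cong (_/ (suc k + 2 * j)) (Ballot-closed (suc k) j) ⟩
  catK (suc k) j                                       ∎
  where open ≡-Reasoning

indicator : Bool → ℕ
indicator true  = 1
indicator false = 0

countᵇ : {A : Set} → (A → Bool) → List A → ℕ
countᵇ p xs = sum (map (indicator ∘ p) xs)

module _ {A : Set} where

  sum-map-cong∈ : ∀ {f g : A → ℕ} xs → (∀ {x} → x ∈ xs → f x ≡ g x) → sum (map f xs) ≡ sum (map g xs)
  sum-map-cong∈ []       _  = refl
  sum-map-cong∈ (x ∷ xs) eq = cong₂ _+_ (eq (here refl)) (sum-map-cong∈ xs (eq ∘ there))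

  sum-map-+ : ∀ (f g : A → ℕ) xs → sum (map (λ x → f x + g x) xs) ≡ sum (map f xs) + sum (map g xs)
  sum-map-+ f g []       = refl
  sum-map-+ f g (x ∷ xs) = trans (cong (f x + g x +_) (sum-map-+ f g xs)) (interchange (f x) (g x) _ _)
    where
    interchange : ∀ a b c d → a + b + (c + d) ≡ a + c + (b + d)
    interchange = solve-∀

  sum-map-concatMap : ∀ {B : Set} (f : B → ℕ) (g : A → List B) xs →
                      sum (map f (concatMap g xs)) ≡ sum (map (λ x → sum (map f (g x))) xs)
  sum-map-concatMap f g []       = refl
  sum-map-concatMap f g (x ∷ xs) = begin
    sum (map f (g x ++ concatMap g xs))               ≡⟨ cong sum (map-++ f (g x) (concatMap g xs)) ⟩
    sum (map f (g x) ++ map f (concatMap g xs))       ≡⟨ sum-++ (map f (g x)) _ ⟩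
    sum (map f (g x)) + sum (map f (concatMap g xs))  ≡⟨ cong (sum (map f (g x)) +_) (sum-map-concatMap f g xs) ⟩
    sum (map f (g x)) + sum (map (λ x → sum (map f (g x))) xs) ∎
    where open ≡-Reasoning

  sum-map-map : ∀ {B : Set} (f : B → ℕ) (g : A → B) xs → sum (map f (map g xs)) ≡ sum (map (f ∘ g) xs)
  sum-map-map f g []       = refl
  sum-map-map f g (x ∷ xs) = cong (f (g x) +_) (sum-map-map f g xs)

  countᵇ-filter : ∀ {P : Pred A 0ℓ} (P? : Decidable P) (p : A → Bool) xs →
                  countᵇ p (filter P? xs) ≡ countᵇ (λ x → does (P? x) ∧ p x) xs
  countᵇ-filter P? p []       = refl
  countᵇ-filter P? p (x ∷ xs) with does (P? x)
  ... | true  = cong (indicator (p x) +_) (countᵇ-filter P? p xs)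
  ... | false = countᵇ-filter P? p xs

  length-filter≡countᵇ : ∀ {P : Pred A 0ℓ} (P? : Decidable P) xs → length (filter P? xs) ≡ countᵇ (does ∘ P?) xs
  length-filter≡countᵇ P? []       = refl
  length-filter≡countᵇ P? (x ∷ xs) with does (P? x)
  ... | true  = cong suc (length-filter≡countᵇ P? xs)
  ... | false = length-filter≡countᵇ P? xs

countBelow : ℕ → (ℕ → Bool) → ℕ
countBelow zero    q = 0
countBelow (suc k) q = indicator (q 0) + countBelow k (q ∘ suc)

countᵇ-tabulate : ∀ {A : Set} {k} (p : A → Bool) (q : ℕ → Bool) (f : Fin k → A) →
                  (∀ i → p (f i) ≡ q (toℕ i)) → countᵇ p (tabulate f) ≡ countBelow k q
countᵇ-tabulate {k = zero}  p q f eq = refl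
countᵇ-tabulate {k = suc k} p q f eq =
  cong₂ (λ b n → indicator b + n) (eq fz) (countᵇ-tabulate p (q ∘ suc) (f ∘ fs) (eq ∘ fs))

countBelow-false : ∀ k → countBelow k (λ _ → false) ≡ 0
countBelow-false zero    = refl
countBelow-false (suc k) = countBelow-false k

countBelow-true : ∀ k → countBelow k (λ _ → true) ≡ k
countBelow-true zero    = refl
countBelow-true (suc k) = cong suc (countBelow-true k)

countBelow-cong : ∀ k {q r : ℕ → Bool} → (∀ x → q x ≡ r x) → countBelow k q ≡ countBelow k r
countBelow-cong zero    eq = refl
countBelow-cong (suc k) eq = cong₂ (λ b n → indicator b + n) (eq 0) (countBelow-cong k (eq ∘ suc))

1+m≤ᵇ1+n : ∀ m n → (suc m ≤ᵇ suc n) ≡ (m ≤ᵇ n)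
1+m≤ᵇ1+n zero    n = refl
1+m≤ᵇ1+n (suc m) n = refl

countBelow-≤ᵇ : ∀ k L (q : ℕ → Bool) → L < k → countBelow k (λ x → (x ≤ᵇ L) ∧ q x) ≡ countBelow (suc L) q
countBelow-≤ᵇ (suc k) zero    q _         = cong (indicator (q 0) +_) (countBelow-false k)
countBelow-≤ᵇ (suc k) (suc L) q (s≤s L<k) = cong (indicator (q 0) +_) (trans
  (countBelow-cong k (λ x → cong (_∧ q (suc x)) (1+m≤ᵇ1+n x L))) (countBelow-≤ᵇ k L (q ∘ suc) L<k))

countBelow-≥ : ∀ k m → countBelow k (m ≤ᵇ_) ≡ k ∸ m
countBelow-≥ zero    m             = sym (0∸n≡0 m)
countBelow-≥ (suc k) zero          = cong suc (countBelow-true k)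
countBelow-≥ (suc k) (suc zero)    = countBelow-true k
countBelow-≥ (suc k) (suc (suc m)) = countBelow-≥ k (suc m)

module _ {A : Set} where

  lookup-injective : ∀ {xs : List A} → Unique xs → ∀ i j → List.lookup xs i ≡ List.lookup xs j → i ≡ j
  lookup-injective (_ ∷ _)    fz     fz     _  = refl
  lookup-injective (x∉xs ∷ _) fz     (fs j) eq = ⊥-elim (All.lookup x∉xs (∈-lookup j) eq)
  lookup-injective (x∉xs ∷ _) (fs i) fz     eq = ⊥-elim (All.lookup x∉xs (∈-lookup i) (sym eq))
  lookup-injective (_ ∷ uniq) (fs i) (fs j) eq = cong fs (lookup-injective uniq i j eq)

  unique-concatMap : ∀ {B : Set} (g : B → List A) (source : A → B) → (∀ {b a} → a ∈ g b → source a ≡ b) →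
                     (∀ b → Unique (g b)) → ∀ {bs} → Unique bs → Unique (concatMap g bs)
  unique-concatMap g source source-g unique-g []                   = []
  unique-concatMap g source source-g unique-g {b ∷ bs} (b∉bs ∷ ubs) =
    Unique.++⁺ (unique-g b) (unique-concatMap g source source-g unique-g ubs) disjoint
    where
    not-later : ∀ {a cs} → source a ≡ b → All (b ≢_) cs → Any (λ c → a ∈ g c) cs → ⊥
    not-later eq (b≢c All.∷ _)  (here a∈gc)  = b≢c (trans (sym eq) (source-g a∈gc))
    not-later eq (_ All.∷ b∉cs) (there a∈gc) = not-later eq b∉cs a∈gc
    disjoint : ∀ {a} → a ∈ g b × a ∈ concatMap g bs → ⊥
    disjoint (a∈gb , a∈rest) = not-later (source-g a∈gb) b∉bs (∈-concatMap⁻ g {xs = bs} a∈rest)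

record MemberInjection {A B : Set} (xs : List A) (ys : List B) : Set where
  field
    to           : ∀ {x} → x ∈ xs → B
    to-∈         : ∀ {x} (p : x ∈ xs) → to p ∈ ys
    to-injective : ∀ {x y} (p : x ∈ xs) (q : y ∈ xs) → to p ≡ to q → x ≡ y

module _ {A B : Set} {xs : List A} {ys : List B} where

  length-≤ : Unique xs → MemberInjection xs ys → length xs ≤ length ys
  length-≤ uniq inj = Fin.injective⇒≤ {f = position} position-injective
    where
    open MemberInjection inj
    to-∈-lookup : ∀ i → to (∈-lookup i) ∈ ys
    to-∈-lookup i = to-∈ (∈-lookup i)
    position : Fin (length xs) → Fin (length ys)
    position i = Any.index (to-∈-lookup i)
    position-injective : ∀ {i j} → position i ≡ position j → i ≡ j
    position-injective {i} {j} eq = lookup-injective uniq i j (to-injective (∈-lookup i) (∈-lookup j)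
      (trans (lookup-index (to-∈-lookup i)) (trans (cong (List.lookup ys) eq) (sym (lookup-index (to-∈-lookup j))))))

length-≡ : ∀ {A B : Set} {xs : List A} {ys : List B} →
           Unique xs → Unique ys → MemberInjection xs ys → MemberInjection ys xs → length xs ≡ length ys
length-≡ uxs uys f g = ≤-antisym (length-≤ uxs f) (length-≤ uys g)

words-complete : ∀ {n k} (v : Vec (Fin n) k) → v ∈ words n k
words-complete []          = here refl
words-complete {n} (x ∷ w) = ∈-concatMap⁺ (λ w → map (_∷ w) (allFin n))
  (Any.map (λ { refl → ∈-map⁺ (_∷ _) (∈-allFin x) }) (words-complete w))

words-unique : ∀ n k → Unique (words n k)
words-unique n zero    = All.[] ∷ []
words-unique n (suc k) = unique-concatMap (λ w → map (_∷ w) (allFin n)) Vec.tail tail-∈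
  (λ w → Unique.map⁺ Vec.∷-injectiveˡ (Unique.allFin⁺ n)) (words-unique n k)
  where
  tail-∈ : ∀ {w v} → v ∈ map (_∷ w) (allFin n) → Vec.tail v ≡ w
  tail-∈ {w} v∈ with ∈-map⁻ (_∷ w) v∈
  ... | _ , _ , refl = refl

injective⇒surjective : ∀ {n} {f : Fin n → Fin n} → (∀ {i j} → f i ≡ f j → i ≡ j) → ∀ p → ∃ λ i → f i ≡ p
injective⇒surjective {suc n} {f} f-injective p with Fin.any? (λ i → f i Fin.≟ p)
... | yes hit  = hit
... | no  miss = ⊥-elim (Fin.<⇒notInjective ≤-refl squeezed-injective)
  where
  squeezed : Fin (suc n) → Fin n
  squeezed i = punchOut {i = p} {j = f i} (λ eq → miss (i , sym eq))
  squeezed-injective : ∀ {i j} → squeezed i ≡ squeezed j → i ≡ j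
  squeezed-injective eq = f-injective (Fin.punchOut-injective {i = p} _ _ eq)

IsPerm⇒injective : ∀ {n} (σ : Vec (Fin n) n) → IsPerm σ → ∀ {i j} → lookup σ i ≡ lookup σ j → i ≡ j
IsPerm⇒injective {n} σ perm {i} {j} σi≡σj =
  trans (sym (section∘σ i)) (trans (cong section σi≡σj) (section∘σ j))
  where
  section : Fin n → Fin n
  section b = proj₁ (perm b)
  section-injective : ∀ {a b} → section a ≡ section b → a ≡ b
  section-injective {a} {b} eq = trans (sym (proj₂ (perm a))) (trans (cong (lookup σ) eq) (proj₂ (perm b)))
  section∘σ : ∀ i → section (lookup σ i) ≡ i
  section∘σ i with injective⇒surjective section-injective i
  ... | a , refl = cong section (proj₂ (perm a))

≗-lookup⇒≡ : ∀ {A : Set} {n} (xs ys : Vec A n) → (∀ i → lookup xs i ≡ lookup ys i) → xs ≡ ys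
≗-lookup⇒≡ xs ys eq = trans (sym (Vec.tabulate∘lookup xs)) (trans (Vec.tabulate-cong eq) (Vec.tabulate∘lookup ys))

-- The junk value j when j does not occur in π keeps inverse total.
positionOf : ∀ {n} → Vec (Fin n) n → Fin n → Fin n
positionOf π j with Fin.any? (λ i → lookup π i Fin.≟ j)
... | yes (i , _) = i
... | no  _       = j

lookup-positionOf : ∀ {n} (π : Vec (Fin n) n) → IsPerm π → ∀ j → lookup π (positionOf π j) ≡ j
lookup-positionOf π perm j with Fin.any? (λ i → lookup π i Fin.≟ j)
... | yes (_ , πi≡j) = πi≡j
... | no  absent     = ⊥-elim (absent (perm j))

inverse : ∀ {n} → Vec (Fin n) n → Vec (Fin n) n
inverse π = Vec.tabulate (positionOf π)

module _ {n} (π : Vec (Fin n) n) (perm : IsPerm π) where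

  lookup∘inverse : ∀ j → lookup π (lookup (inverse π) j) ≡ j
  lookup∘inverse j = trans (cong (lookup π) (Vec.lookup∘tabulate (positionOf π) j)) (lookup-positionOf π perm j)

  inverse∘lookup : ∀ i → lookup (inverse π) (lookup π i) ≡ i
  inverse∘lookup i = IsPerm⇒injective π perm (lookup∘inverse (lookup π i))

  inverse-IsPerm : IsPerm (inverse π)
  inverse-IsPerm i = lookup π i , inverse∘lookup i

inverse-involutive : ∀ {n} (π : Vec (Fin n) n) → IsPerm π → inverse (inverse π) ≡ π
inverse-involutive π perm = ≗-lookup⇒≡ _ _ λ i → IsPerm⇒injective (inverse π) (inverse-IsPerm π perm)
  (trans (lookup∘inverse (inverse π) (inverse-IsPerm π perm) i) (sym (inverse∘lookup π perm i)))

inverse-Av321 : ∀ {n} (π : Vec (Fin n) n) → Av321 π → Av321 (inverse π)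
inverse-Av321 π (perm , avoids) = inverse-IsPerm π perm , λ (a , b , c , a<b , b<c , πa>πb , πb>πc) →
  avoids (ι c , ι b , ι a , πb>πc , πa>πb ,
          subst₂ (λ x y → toℕ x < toℕ y) (sym (lookup∘inverse π perm b)) (sym (lookup∘inverse π perm c)) b<c ,
          subst₂ (λ x y → toℕ x < toℕ y) (sym (lookup∘inverse π perm a)) (sym (lookup∘inverse π perm b)) a<b)
  where
  ι : Fin _ → Fin _
  ι = lookup (inverse π)

reverseComplement : ∀ {n} → Vec (Fin n) n → Vec (Fin n) n
reverseComplement π = Vec.tabulate (λ i → opposite (lookup π (opposite i)))

lookup-reverseComplement : ∀ {n} (π : Vec (Fin n) n) i →
                           lookup (reverseComplement π) i ≡ opposite (lookup π (opposite i))
lookup-reverseComplement π i = Vec.lookup∘tabulate _ i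

lookup-reverseComplement-opposite : ∀ {n} (π : Vec (Fin n) n) i →
                                    lookup (reverseComplement π) (opposite i) ≡ opposite (lookup π i)
lookup-reverseComplement-opposite π i =
  trans (lookup-reverseComplement π (opposite i)) (cong (opposite ∘ lookup π) (Fin.opposite-involutive i))

reverseComplement-involutive : ∀ {n} (π : Vec (Fin n) n) → reverseComplement (reverseComplement π) ≡ π
reverseComplement-involutive π = ≗-lookup⇒≡ _ _ λ i → begin
  lookup (reverseComplement (reverseComplement π)) i    ≡⟨ lookup-reverseComplement (reverseComplement π) i ⟩
  opposite (lookup (reverseComplement π) (opposite i))  ≡⟨ cong opposite (lookup-reverseComplement-opposite π i) ⟩
  opposite (opposite (lookup π i))                      ≡⟨ Fin.opposite-involutive _ ⟩
  lookup π i                                            ∎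
  where open ≡-Reasoning

opposite-< : ∀ {n} {a b : Fin n} → toℕ a < toℕ b → toℕ (opposite b) < toℕ (opposite a)
opposite-< {a = a} {b} a<b =
  subst₂ _<_ (sym (Fin.opposite-prop b)) (sym (Fin.opposite-prop a)) (∸-monoʳ-< (s≤s a<b) (Fin.toℕ<n b))

opposite-<⁻¹ : ∀ {n} {a b : Fin n} → toℕ (opposite a) < toℕ (opposite b) → toℕ b < toℕ a
opposite-<⁻¹ {a = a} {b} lt =
  subst₂ (λ x y → toℕ x < toℕ y) (Fin.opposite-involutive b) (Fin.opposite-involutive a) (opposite-< lt)

reverseComplement-Av321 : ∀ {n} (π : Vec (Fin n) n) → Av321 π → Av321 (reverseComplement π)
reverseComplement-Av321 π (perm , avoids) = perm′ , avoids′
  where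
  ρ : Vec (Fin _) _
  ρ = reverseComplement π
  perm′ : IsPerm ρ
  perm′ j with perm (opposite j)
  ... | i , πi≡j′ = opposite i , (begin
    lookup ρ (opposite i)        ≡⟨ lookup-reverseComplement-opposite π i ⟩
    opposite (lookup π i)        ≡⟨ cong opposite πi≡j′ ⟩
    opposite (opposite j)        ≡⟨ Fin.opposite-involutive j ⟩
    j                            ∎)
    where open ≡-Reasoning
  values : ∀ x y → toℕ (lookup ρ x) < toℕ (lookup ρ y) → toℕ (lookup π (opposite y)) < toℕ (lookup π (opposite x))
  values x y lt = opposite-<⁻¹ (subst₂ (λ u v → toℕ u < toℕ v) (lookup-reverseComplement π x) (lookup-reverseComplement π y) lt)
  avoids′ : Avoids321 ρ
  avoids′ (i , j , k , i<j , j<k , ρi>ρj , ρj>ρk) =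
    avoids (opposite k , opposite j , opposite i , opposite-< j<k , opposite-< i<j , values k j ρj>ρk , values j i ρi>ρj)

-- A code lists the first letter of a permutation, then that of its standardised tail, and so on;
-- label c is the label of decode c, computed along the code.
data Code : ℕ → Set where
  nil : Code 0
  _◂_ : ∀ {n} → Fin (suc n) → Code n → Code (suc n)

nextLabel : ℕ → ℕ → ℕ
nextLabel L zero    = suc L
nextLabel L (suc w) = suc w

label : ∀ {n} → Code n → ℕ
label nil     = 0
label (v ◂ c) = nextLabel (label c) (toℕ v)

Valid : ∀ {n} → Code n → Set
Valid nil     = ⊤
Valid (v ◂ c) = toℕ v ≤ label c × Valid c

children : (n : ℕ) → Code n → List (Code (suc n))
children n c = map (_◂ c) (filter (λ v → toℕ v ≤? label c) (allFin (suc n)))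

codes : (n : ℕ) → List (Code n)
codes zero    = nil ∷ []
codes (suc n) = concatMap (children n) (codes n)

codes-sound : ∀ {n} {c : Code n} → c ∈ codes n → Valid c
codes-sound {zero}  {nil} _  = tt
codes-sound {suc n}       c∈ with find (∈-concatMap⁻ (children n) {xs = codes n} c∈)
codes-sound {suc n}       c∈ | c′ , c′∈ , c∈children with ∈-map⁻ (_◂ c′) c∈children
... | v , v∈ , refl = proj₂ (∈-filter⁻ (λ v → toℕ v ≤? label c′) {xs = allFin _} v∈) , codes-sound c′∈

codes-complete : ∀ {n} (c : Code n) → Valid c → c ∈ codes n
codes-complete nil                  _            = here refl
codes-complete {suc n} (v ◂ c) (v≤label , valid) = ∈-concatMap⁺ (children n)
  (Any.map (λ { refl → ∈-map⁺ (_◂ c) (∈-filter⁺ (λ v → toℕ v ≤? label c) (∈-allFin v) v≤label) })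
           (codes-complete c valid))

codes-unique : ∀ n → Unique (codes n)
codes-unique zero    = All.[] ∷ []
codes-unique (suc n) = unique-concatMap (children n) tail tail-∈
  (λ c → Unique.map⁺ head-injective (Unique.filter⁺ (λ v → toℕ v ≤? label c) (Unique.allFin⁺ (suc n))))
  (codes-unique n)
  where
  tail : Code (suc n) → Code n
  tail (_ ◂ c) = c
  tail-∈ : ∀ {c a} → a ∈ children n c → tail a ≡ c
  tail-∈ {c} a∈ with ∈-map⁻ (_◂ c) a∈
  ... | _ , _ , refl = refl
  head-injective : ∀ {v v′ : Fin (suc n)} {c c′ : Code n} → v ◂ c ≡ v′ ◂ c′ → v ≡ v′
  head-injective refl = refl

label-≤ : ∀ {n} {c : Code n} → Valid c → label c ≤ n
label-≤ {c = nil}       _           = z≤n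
label-≤ {suc n} {v ◂ c} (_ , valid) = nextLabel-≤ (toℕ v) (Fin.toℕ<n v)
  where
  nextLabel-≤ : ∀ w → w < suc n → nextLabel (label c) w ≤ suc n
  nextLabel-≤ zero    _         = s≤s (label-≤ valid)
  nextLabel-≤ (suc w) (s≤s w<n) = m≤n⇒m≤1+n w<n

toℕ-punchIn-< : ∀ {n} (v : Fin (suc n)) (j : Fin n) → toℕ j < toℕ v → toℕ (punchIn v j) ≡ toℕ j
toℕ-punchIn-< (fs v) fz     _         = refl
toℕ-punchIn-< (fs v) (fs j) (s≤s j<v) = cong suc (toℕ-punchIn-< v j j<v)

toℕ-punchIn-≥ : ∀ {n} (v : Fin (suc n)) (j : Fin n) → toℕ v ≤ toℕ j → toℕ (punchIn v j) ≡ suc (toℕ j)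
toℕ-punchIn-≥ fz     j      _         = refl
toℕ-punchIn-≥ (fs v) (fs j) (s≤s v≤j) = cong suc (toℕ-punchIn-≥ v j v≤j)

punchIn-< : ∀ {n} (v : Fin (suc n)) {a b : Fin n} → toℕ a < toℕ b → toℕ (punchIn v a) < toℕ (punchIn v b)
punchIn-< fz     a<b                     = s≤s a<b
punchIn-< (fs v) {fz}   {fs b} _         = s≤s z≤n
punchIn-< (fs v) {fs a} {fs b} (s≤s a<b) = s≤s (punchIn-< v a<b)

punchIn-<⁻¹ : ∀ {n} (v : Fin (suc n)) {a b : Fin n} → toℕ (punchIn v a) < toℕ (punchIn v b) → toℕ a < toℕ b
punchIn-<⁻¹ fz     (s≤s a<b)               = a<b
punchIn-<⁻¹ (fs v) {fz}   {fs b} _         = s≤s z≤n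
punchIn-<⁻¹ (fs v) {fs a} {fs b} (s≤s a<b) = s≤s (punchIn-<⁻¹ v a<b)

prepend : ∀ {n} → Fin (suc n) → Vec (Fin n) n → Vec (Fin (suc n)) (suc n)
prepend v π = v ∷ Vec.map (punchIn v) π

decode : ∀ {n} → Code n → Vec (Fin n) n
decode nil     = []
decode (v ◂ c) = prepend v (decode c)

module _ {n} (v : Fin (suc n)) (π : Vec (Fin n) n) where

  lookup-prepend : ∀ i → lookup (prepend v π) (fs i) ≡ punchIn v (lookup π i)
  lookup-prepend i = Vec.lookup-map i (punchIn v) π

  prepend-< : ∀ i j → toℕ (lookup π i) < toℕ (lookup π j) →
              toℕ (lookup (prepend v π) (fs i)) < toℕ (lookup (prepend v π) (fs j))
  prepend-< i j lt = subst₂ (λ x y → toℕ x < toℕ y) (sym (lookup-prepend i)) (sym (lookup-prepend j)) (punchIn-< v lt)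

  prepend-<⁻¹ : ∀ i j → toℕ (lookup (prepend v π) (fs i)) < toℕ (lookup (prepend v π) (fs j)) →
                toℕ (lookup π i) < toℕ (lookup π j)
  prepend-<⁻¹ i j lt = punchIn-<⁻¹ v (subst₂ (λ x y → toℕ x < toℕ y) (lookup-prepend i) (lookup-prepend j) lt)

prepend-injective : ∀ {n} {v w : Fin (suc n)} {π τ : Vec (Fin n) n} → prepend v π ≡ prepend w τ → v ≡ w × π ≡ τ
prepend-injective {v = v} {π = π} {τ} eq with Vec.∷-injectiveˡ eq
... | refl = refl , ≗-lookup⇒≡ π τ λ i → Fin.punchIn-injective v _ _
  (trans (sym (lookup-prepend v π i)) (trans (cong (λ σ → lookup σ (fs i)) eq) (lookup-prepend v τ i)))

InversionTops≥ : ∀ {n} → Vec (Fin n) n → ℕ → Set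
InversionTops≥ π u = ∀ i j → toℕ i < toℕ j → toℕ (lookup π j) < toℕ (lookup π i) → u ≤ toℕ (lookup π i)

≤nextLabel⇒≤1+ : ∀ {L t u} → t ≤ L → suc u ≤ nextLabel L t → u ≤ L
≤nextLabel⇒≤1+ {t = zero}  _   (s≤s u≤L) = u≤L
≤nextLabel⇒≤1+ {t = suc t} t≤L (s≤s u≤t) = ≤-trans (m≤n⇒m≤1+n u≤t) t≤L

≤label⇒InversionTops≥ : ∀ {n} (c : Code n) → Valid c → ∀ u → u ≤ label c → InversionTops≥ (decode c) u
≤label⇒InversionTops≥ (fz ◂ c)   _ _ _ fz (fs j) _ πj<0 =
  ⊥-elim (n≮0 (subst (λ x → toℕ x < 0) (lookup-prepend fz (decode c) j) πj<0))
≤label⇒InversionTops≥ (fs w ◂ c) _ _ u≤label fz (fs j) _ _ = u≤label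
≤label⇒InversionTops≥ (w ◂ c) (w≤label , valid) u u≤label (fs i) (fs j) (s≤s i<j) πj<πi =
  subst (u ≤_) (sym top) (bound u u≤label)
  where
  π : Vec (Fin _) _
  π = decode c
  a : Fin _
  a = lookup π i
  inversion : toℕ (lookup π j) < toℕ a
  inversion = prepend-<⁻¹ w π j i πj<πi
  top : toℕ (lookup (prepend w π) (fs i)) ≡ suc (toℕ a)
  top = trans (cong toℕ (lookup-prepend w π i))
              (toℕ-punchIn-≥ w a (≤label⇒InversionTops≥ c valid (toℕ w) w≤label i j i<j inversion))
  bound : ∀ u → u ≤ nextLabel (label c) (toℕ w) → u ≤ suc (toℕ a)
  bound zero     _ = z≤n
  bound (suc u′) le = s≤s (≤label⇒InversionTops≥ c valid u′ (≤nextLabel⇒≤1+ w≤label le) i j i<j inversion)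

prepend-IsPerm : ∀ {n} (v : Fin (suc n)) (π : Vec (Fin n) n) → IsPerm π → IsPerm (prepend v π)
prepend-IsPerm v π perm j with v Fin.≟ j
... | yes v≡j = fz , v≡j
... | no  v≢j = fs (proj₁ (perm (punchOut v≢j))) , (begin
  lookup (prepend v π) (fs (proj₁ (perm (punchOut v≢j)))) ≡⟨ lookup-prepend v π _ ⟩
  punchIn v (lookup π (proj₁ (perm (punchOut v≢j))))     ≡⟨ cong (punchIn v) (proj₂ (perm (punchOut v≢j))) ⟩
  punchIn v (punchOut v≢j)                               ≡⟨ Fin.punchIn-punchOut v≢j ⟩
  j                                                      ∎)
  where open ≡-Reasoning

-- A 321 through the first letter v is v > π_j > π_k, an inversion of π whose top is below v.
prepend-Avoids321 : ∀ {n} (v : Fin (suc n)) (π : Vec (Fin n) n) →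
                    Avoids321 π → InversionTops≥ π (toℕ v) → Avoids321 (prepend v π)
prepend-Avoids321 v π avoids tops (fz , fs j , fs k , _ , s≤s j<k , πj<v , πk<πj) =
  <-irrefl refl (≤-trans (n≤1+n _) (≤-trans (subst (λ z → suc z ≤ toℕ v) top πj<v) v≤πj))
  where
  v≤πj : toℕ v ≤ toℕ (lookup π j)
  v≤πj = tops j k j<k (prepend-<⁻¹ v π k j πk<πj)
  top : toℕ (lookup (prepend v π) (fs j)) ≡ suc (toℕ (lookup π j))
  top = trans (cong toℕ (lookup-prepend v π j)) (toℕ-punchIn-≥ v _ v≤πj)
prepend-Avoids321 v π avoids tops (fs i , fs j , fs k , s≤s i<j , s≤s j<k , πj<πi , πk<πj) =
  avoids (i , j , k , i<j , j<k , prepend-<⁻¹ v π j i πj<πi , prepend-<⁻¹ v π k j πk<πj)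

decode-Av321 : ∀ {n} (c : Code n) → Valid c → Av321 (decode c)
decode-Av321 nil     _                 = (λ ()) , λ ()
decode-Av321 (w ◂ c) (w≤label , valid) with decode-Av321 c valid
... | perm , avoids =
  prepend-IsPerm w (decode c) perm , prepend-Avoids321 w (decode c) avoids (≤label⇒InversionTops≥ c valid (toℕ w) w≤label)

InversionTops≥⇒≤label : ∀ {n} (c : Code n) → Valid c → ∀ u → u ≤ n → InversionTops≥ (decode c) u → u ≤ label c
InversionTops≥⇒≤label nil      _          u       u≤0       _    = u≤0
InversionTops≥⇒≤label (fz ◂ c) _          zero    _         _    = z≤n
InversionTops≥⇒≤label (fz ◂ c) (_ , valid) (suc u) (s≤s u≤n) tops = s≤s (InversionTops≥⇒≤label c valid u u≤n shifted)
  where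
  π : Vec (Fin _) _
  π = decode c
  shifted : InversionTops≥ π u
  shifted i j i<j πj<πi = s≤s⁻¹ (subst (suc u ≤_) (cong toℕ (lookup-prepend fz π i))
    (tops (fs i) (fs j) (s≤s i<j) (prepend-< fz π j i πj<πi)))
InversionTops≥⇒≤label {suc (suc n)} (fs w ◂ c) (_ , valid) u _ tops = tops fz (fs i) (s≤s z≤n) zero-after
  where
  π : Vec (Fin _) _
  π = decode c
  i : Fin _
  i = proj₁ (proj₁ (decode-Av321 c valid) fz)
  zero-after : toℕ (lookup (prepend (fs w) π) (fs i)) < toℕ (fs w)
  zero-after = subst (λ z → toℕ z < suc (toℕ w))
    (sym (trans (lookup-prepend (fs w) π i) (cong (punchIn (fs w)) (proj₂ (proj₁ (decode-Av321 c valid) fz)))))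
    (s≤s z≤n)

decode-injective : ∀ {n} {c c′ : Code n} → decode c ≡ decode c′ → c ≡ c′
decode-injective {c = nil}   {nil}     _  = refl
decode-injective {c = v ◂ c} {v′ ◂ c′} eq with prepend-injective eq
... | refl , π≡π′ = cong (v ◂_) (decode-injective π≡π′)

prepend-IsPerm⁻¹ : ∀ {n} (v : Fin (suc n)) (π : Vec (Fin n) n) → IsPerm (prepend v π) → IsPerm π
prepend-IsPerm⁻¹ v π perm j with perm (punchIn v j)
... | fz   , v≡vj  = ⊥-elim (Fin.punchInᵢ≢i v j (sym v≡vj))
... | fs i , πi≡vj = i , Fin.punchIn-injective v _ _ (trans (sym (lookup-prepend v π i)) πi≡vj)

prepend-Has321 : ∀ {n} (v : Fin (suc n)) (π : Vec (Fin n) n) → Has321 π → Has321 (prepend v π)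
prepend-Has321 v π (i , j , k , i<j , j<k , πj<πi , πk<πj) =
  fs i , fs j , fs k , s≤s i<j , s≤s j<k , prepend-< v π j i πj<πi , prepend-< v π k j πk<πj

prepend-InversionTops≥ : ∀ {n} (v : Fin (suc n)) (π : Vec (Fin n) n) →
                         Avoids321 (prepend v π) → InversionTops≥ π (toℕ v)
prepend-InversionTops≥ v π avoids i j i<j πj<πi with toℕ v ≤? toℕ (lookup π i)
... | yes v≤πi = v≤πi
... | no  v≰πi = ⊥-elim (avoids (fz , fs i , fs j , s≤s z≤n , s≤s i<j , πi<v , prepend-< v π j i πj<πi))
  where
  πi<v : toℕ (lookup (prepend v π) (fs i)) < toℕ v
  πi<v = subst (_< toℕ v)
    (sym (trans (cong toℕ (lookup-prepend v π i)) (toℕ-punchIn-< v _ (≰⇒> v≰πi)))) (≰⇒> v≰πi)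

prepend-view : ∀ {n} (w : Fin (suc n)) (τ : Vec (Fin (suc n)) n) → IsPerm (w ∷ τ) →
               Σ (Vec (Fin n) n) λ π → prepend w π ≡ w ∷ τ
prepend-view w τ perm = Vec.tabulate rest , cong (w ∷_) (≗-lookup⇒≡ _ _ λ i → begin
  lookup (Vec.map (punchIn w) (Vec.tabulate rest)) i ≡⟨ Vec.lookup-map i (punchIn w) (Vec.tabulate rest) ⟩
  punchIn w (lookup (Vec.tabulate rest) i)           ≡⟨ cong (punchIn w) (Vec.lookup∘tabulate rest i) ⟩
  punchIn w (rest i)                                 ≡⟨ Fin.punchIn-punchOut (w≢τ i) ⟩
  lookup τ i                                         ∎)
  where
  open ≡-Reasoning
  w≢τ : ∀ i → w ≢ lookup τ i
  w≢τ i eq with IsPerm⇒injective (w ∷ τ) perm {fz} {fs i} eq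
  ... | ()
  rest : Fin _ → Fin _
  rest i = punchOut (w≢τ i)

decode-surjective : ∀ {n} (σ : Vec (Fin n) n) → Av321 σ → Σ (Code n) λ c → Valid c × decode c ≡ σ
decode-surjective []      _                = nil , tt , refl
decode-surjective (w ∷ τ) (perm , avoids) with prepend-view w τ perm
... | π , refl with decode-surjective π (prepend-IsPerm⁻¹ w π perm , avoids ∘ prepend-Has321 w π)
... | c , valid , refl = w ◂ c , (w≤label , valid) , refl
  where
  w≤label : toℕ w ≤ label c
  w≤label = InversionTops≥⇒≤label c valid (toℕ w) (s≤s⁻¹ (Fin.toℕ<n w)) (prepend-InversionTops≥ w (decode c) avoids)

module _ {n} {P : Pred (Vec (Fin n) n) 0ℓ} (P? : Decidable P) where

  private
    Av321∧P? : Decidable (λ π → Av321 π × P π)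
    Av321∧P? π = av321? π ×-dec P? π
    selected : List (Vec (Fin n) n)
    selected = filter Av321∧P? (words n n)

  selected⁻ : ∀ {π} → π ∈ selected → Av321 π × P π
  selected⁻ π∈ = proj₂ (∈-filter⁻ Av321∧P? {xs = words n n} π∈)

  selected⁺ : ∀ {π} → Av321 π → P π → π ∈ selected
  selected⁺ {π} av p = ∈-filter⁺ Av321∧P? (words-complete π) (av , p)

  selected-unique : Unique selected
  selected-unique = Unique.filter⁺ Av321∧P? (words-unique n n)

  count321≡countᵇ-codes : count321 n P P? ≡ countᵇ (λ c → does (P? (decode c))) (codes n)
  count321≡countᵇ-codes = trans (sym (length-≡ chosen-unique selected-unique decoding encoding))
                                (length-filter≡countᵇ (P? ∘ decode) (codes n))
    where
    chosen : List (Code n)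
    chosen = filter (P? ∘ decode) (codes n)
    chosen-unique : Unique chosen
    chosen-unique = Unique.filter⁺ (P? ∘ decode) (codes-unique n)
    chosen⁻ : ∀ {c} → c ∈ chosen → c ∈ codes n × P (decode c)
    chosen⁻ = ∈-filter⁻ (P? ∘ decode) {xs = codes n}
    decoding : MemberInjection chosen selected
    decoding = record
      { to           = λ {c} _ → decode c
      ; to-∈         = λ {c} c∈ → let c∈codes , p = chosen⁻ c∈ in selected⁺ (decode-Av321 c (codes-sound c∈codes)) p
      ; to-injective = λ _ _ → decode-injective
      }
    preimage : ∀ {π} → π ∈ selected → Σ (Code n) λ c → Valid c × decode c ≡ π
    preimage {π} π∈ = decode-surjective π (proj₁ (selected⁻ π∈))
    encoding : MemberInjection selected chosen
    encoding = record
      { to           = λ π∈ → proj₁ (preimage π∈)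
      ; to-∈         = λ {π} π∈ → let c , valid , decode-c≡π = preimage π∈ in
                        ∈-filter⁺ (P? ∘ decode) (codes-complete c valid) (subst P (sym decode-c≡π) (proj₂ (selected⁻ π∈)))
      ; to-injective = λ π∈ π′∈ eq → trans (sym (proj₂ (proj₂ (preimage π∈))))
                                           (trans (cong decode eq) (proj₂ (proj₂ (preimage π′∈))))
      }

module _ {n} (f : Vec (Fin n) n → Vec (Fin n) n)
         (f-Av321 : ∀ π → Av321 π → Av321 (f π)) (f-involutive : ∀ π → Av321 π → f (f π) ≡ π) where

  private
    f-injection : ∀ {P Q : Pred (Vec (Fin n) n) 0ℓ} (P? : Decidable P) (Q? : Decidable Q) →
                  (∀ π → Av321 π → P π → Q (f π)) →
                  MemberInjection (filter (λ π → av321? π ×-dec P? π) (words n n))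
                                  (filter (λ π → av321? π ×-dec Q? π) (words n n))
    f-injection P? Q? P⇒Q = record
      { to           = λ {π} _ → f π
      ; to-∈         = λ π∈ → let av , p = selected⁻ P? π∈ in selected⁺ Q? (f-Av321 _ av) (P⇒Q _ av p)
      ; to-injective = λ π∈ π′∈ eq → trans (sym (f-involutive _ (proj₁ (selected⁻ P? π∈))))
                                           (trans (cong f eq) (f-involutive _ (proj₁ (selected⁻ P? π′∈))))
      }

  count321-involution : ∀ {P Q : Pred (Vec (Fin n) n) 0ℓ} (P? : Decidable P) (Q? : Decidable Q) →
                        (∀ π → Av321 π → P π → Q (f π)) → (∀ π → Av321 π → Q π → P (f π)) →
                        count321 n P P? ≡ count321 n Q Q?
  count321-involution P? Q? P⇒Q Q⇒P =
    length-≡ (selected-unique P?) (selected-unique Q?) (f-injection P? Q? P⇒Q) (f-injection Q? P? Q⇒P)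

countᵇ-codes-suc : ∀ n (p : Code (suc n) → Bool) (q : ℕ → ℕ → Bool) → (∀ v c → p (v ◂ c) ≡ q (toℕ v) (label c)) →
                   countᵇ p (codes (suc n)) ≡ sum (map (λ c → countBelow (suc (label c)) (λ x → q x (label c))) (codes n))
countᵇ-codes-suc n p q p≡q =
  trans (sum-map-concatMap (indicator ∘ p) (children n) (codes n)) (sum-map-cong∈ (codes n) per-code)
  where
  per-code : ∀ {c} → c ∈ codes n → countᵇ p (children n c) ≡ countBelow (suc (label c)) (λ x → q x (label c))
  per-code {c} c∈ = begin
    countᵇ p (map (_◂ c) (filter (λ v → toℕ v ≤? label c) (allFin (suc n))))
      ≡⟨ sum-map-map (indicator ∘ p) (_◂ c) (filter (λ v → toℕ v ≤? label c) (allFin (suc n))) ⟩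
    countᵇ (λ v → p (v ◂ c)) (filter (λ v → toℕ v ≤? label c) (allFin (suc n)))
      ≡⟨ countᵇ-filter (λ v → toℕ v ≤? label c) _ (allFin (suc n)) ⟩
    countᵇ (λ v → (toℕ v ≤ᵇ label c) ∧ p (v ◂ c)) (allFin (suc n))
      ≡⟨ countᵇ-tabulate _ (λ x → (x ≤ᵇ label c) ∧ q x (label c)) (λ i → i) (λ i → cong ((toℕ i ≤ᵇ label c) ∧_) (p≡q i c)) ⟩
    countBelow (suc n) (λ x → (x ≤ᵇ label c) ∧ q x (label c))
      ≡⟨ countBelow-≤ᵇ (suc n) (label c) (λ x → q x (label c)) (s≤s (label-≤ (codes-sound c∈))) ⟩
    countBelow (suc (label c)) (λ x → q x (label c)) ∎
    where open ≡-Reasoning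

indicator-≤ᵇ+∸ : ∀ a L → indicator (a ≤ᵇ L) + (L ∸ a) ≡ suc L ∸ a
indicator-≤ᵇ+∸ zero    L       = refl
indicator-≤ᵇ+∸ (suc a) zero    = sym (0∸n≡0 a)
indicator-≤ᵇ+∸ (suc a) (suc L) = trans (cong (λ b → indicator b + (L ∸ a)) (1+m≤ᵇ1+n a L)) (indicator-≤ᵇ+∸ a L)

countBelow-1+≤ᵇ1+ : ∀ k m → countBelow k (λ x → suc m ≤ᵇ suc x) ≡ k ∸ m
countBelow-1+≤ᵇ1+ k m = trans (countBelow-cong k (1+m≤ᵇ1+n m)) (countBelow-≥ k m)

countBelow-≤ᵇnextLabel : ∀ L k → countBelow (suc L) (λ x → k ≤ᵇ nextLabel L x) ≡ suc L ∸ (k ∸ 1)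
countBelow-≤ᵇnextLabel L zero    = cong suc (countBelow-true L)
countBelow-≤ᵇnextLabel L (suc k) =
  trans (cong (indicator (suc k ≤ᵇ suc L) +_) (countBelow-1+≤ᵇ1+ L k))
        (trans (cong (λ b → indicator b + (L ∸ k)) (1+m≤ᵇ1+n k L)) (indicator-≤ᵇ+∸ k L))

countBelow-≤ᵇ1+ : ∀ L m → countBelow (suc L) (λ x → m ≤ᵇ suc x) ≡ suc L ∸ (m ∸ 1)
countBelow-≤ᵇ1+ L zero    = countBelow-true (suc L)
countBelow-≤ᵇ1+ L (suc m) = countBelow-1+≤ᵇ1+ (suc L) m

labelsAtLeast : ℕ → ℕ → ℕ
labelsAtLeast n k = countᵇ (λ c → k ≤ᵇ label c) (codes n)

labelsAtLeast-suc : ∀ n k → labelsAtLeast (suc n) k ≡ sum (map (λ c → suc (label c) ∸ (k ∸ 1)) (codes n))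
labelsAtLeast-suc n k = trans (countᵇ-codes-suc n (λ c → k ≤ᵇ label c) (λ x L → k ≤ᵇ nextLabel L x) (λ _ _ → refl))
                              (sum-map-cong∈ (codes n) (λ {c} _ → countBelow-≤ᵇnextLabel (label c) k))

labelsAtLeast-0≡1 : ∀ n → labelsAtLeast (suc n) 0 ≡ labelsAtLeast (suc n) 1
labelsAtLeast-0≡1 n = trans (labelsAtLeast-suc n 0) (sym (labelsAtLeast-suc n 1))

labelsAtLeast-rec : ∀ n k → labelsAtLeast (suc n) (suc k) ≡ labelsAtLeast n k + labelsAtLeast (suc n) (suc (suc k))
labelsAtLeast-rec n k = begin
  labelsAtLeast (suc n) (suc k)
    ≡⟨ labelsAtLeast-suc n (suc k) ⟩
  sum (map (λ c → suc (label c) ∸ k) (codes n))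
    ≡⟨ sum-map-cong∈ (codes n) (λ {c} _ → sym (indicator-≤ᵇ+∸ k (label c))) ⟩
  sum (map (λ c → indicator (k ≤ᵇ label c) + (label c ∸ k)) (codes n))
    ≡⟨ sum-map-+ (λ c → indicator (k ≤ᵇ label c)) (λ c → label c ∸ k) (codes n) ⟩
  labelsAtLeast n k + sum (map (λ c → label c ∸ k) (codes n))
    ≡⟨ cong (labelsAtLeast n k +_) (labelsAtLeast-suc n (suc (suc k))) ⟨
  labelsAtLeast n k + labelsAtLeast (suc n) (suc (suc k)) ∎
  where open ≡-Reasoning

n<k⇒labelsAtLeast≡0 : ∀ n k → n < k → labelsAtLeast n k ≡ 0
n<k⇒labelsAtLeast≡0 n k n<k = trans (sum-map-cong∈ (codes n) below) (sum-zeros (codes n))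
  where
  below : ∀ {c} → c ∈ codes n → indicator (k ≤ᵇ label c) ≡ 0
  below c∈ = cong indicator (dec-false (k ≤? _) (<⇒≱ (≤-<-trans (label-≤ (codes-sound c∈)) n<k)))
  sum-zeros : ∀ (cs : List (Code n)) → sum (map (λ _ → 0) cs) ≡ 0
  sum-zeros []       = refl
  sum-zeros (_ ∷ cs) = sum-zeros cs

labelsAtLeast≡Ballot : ∀ n k d → k + d ≡ n → labelsAtLeast n k ≡ Ballot (suc k) d
labelsAtLeast≡Ballot zero    zero    zero    _ = refl
labelsAtLeast≡Ballot (suc n) k       zero    k+0≡1+n rewrite +-identityʳ k | k+0≡1+n =
  trans (labelsAtLeast-rec n n)
        (cong₂ _+_ (labelsAtLeast≡Ballot n n 0 (+-identityʳ n)) (n<k⇒labelsAtLeast≡0 (suc n) (suc (suc n)) ≤-refl))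
labelsAtLeast≡Ballot (suc n) zero    (suc d) d≡n   =
  trans (labelsAtLeast-0≡1 n) (labelsAtLeast≡Ballot (suc n) 1 d d≡n)
labelsAtLeast≡Ballot (suc n) (suc k) (suc d) k+1+d≡n =
  trans (labelsAtLeast-rec n k)
        (cong₂ _+_ (labelsAtLeast≡Ballot n k (suc d) (suc-injective k+1+d≡n))
                   (labelsAtLeast≡Ballot (suc n) (suc (suc k)) d (trans (cong suc (sym (+-suc k d))) k+1+d≡n)))

count321-Cond2 : ∀ n m → count321 (suc n) (Cond2 m) (cond2? m) ≡ labelsAtLeast (suc n) m
count321-Cond2 n m = begin
  count321 (suc n) (Cond2 m) (cond2? m)
    ≡⟨ count321≡countᵇ-codes (cond2? {n} m) ⟩
  countᵇ (λ c → does (cond2? m (decode c))) (codes (suc n))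
    ≡⟨ countᵇ-codes-suc n _ (λ x _ → m ≤ᵇ suc x) (λ _ _ → refl) ⟩
  sum (map (λ c → countBelow (suc (label c)) (λ x → m ≤ᵇ suc x)) (codes n))
    ≡⟨ sum-map-cong∈ (codes n) (λ {c} _ → countBelow-≤ᵇ1+ (label c) m) ⟩
  sum (map (λ c → suc (label c) ∸ (m ∸ 1)) (codes n))
    ≡⟨ labelsAtLeast-suc n m ⟨
  labelsAtLeast (suc n) m ∎
  where open ≡-Reasoning

≤1+⇒1+≤2+∸ : ∀ {a b n m} → a + b ≡ n → m ≤ suc a → suc b ≤ suc (suc n) ∸ m
≤1+⇒1+≤2+∸ {a} {b} {m = m} refl m≤1+a = m+n≤o⇒m≤o∸n (suc b)
  (subst (suc b + m ≤_) (cong suc (trans (+-suc b a) (cong suc (+-comm b a)))) (+-monoʳ-≤ (suc b) m≤1+a))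

1+≤2+∸⇒≤1+ : ∀ {a b n m} → a + b ≡ n → suc b ≤ suc (suc n) ∸ m → m ≤ suc a
1+≤2+∸⇒≤1+ {a} {b} {n} {m} a+b≡n 1+b≤ with m ≤? suc (suc n)
... | yes m≤2+n = +-cancelˡ-≤ (suc b) m (suc a)
  (subst (suc b + m ≤_) (cong suc (trans (cong suc (sym a+b≡n)) (trans (cong suc (+-comm a b)) (sym (+-suc b a)))))
         (m≤o∸n⇒m+n≤o (suc b) m≤2+n 1+b≤))
... | no  m≰2+n = ⊥-elim (n≮0 (subst (suc b ≤_) (m≤n⇒m∸n≡0 (<⇒≤ (≰⇒> m≰2+n))) 1+b≤))

toℕ+toℕ-opposite : ∀ {n} (i : Fin (suc n)) → toℕ i + toℕ (opposite i) ≡ n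
toℕ+toℕ-opposite i = trans (cong (toℕ i +_) (Fin.opposite-prop i)) (m+[n∸m]≡n (s≤s⁻¹ (Fin.toℕ<n i)))

≤val⇒val-opposite≤ : ∀ {n m} (i : Fin (suc n)) → m ≤ val i → val (opposite i) ≤ suc (suc n) ∸ m
≤val⇒val-opposite≤ i = ≤1+⇒1+≤2+∸ (toℕ+toℕ-opposite i)

val≤⇒≤val-opposite : ∀ {n m} (i : Fin (suc n)) → val i ≤ suc (suc n) ∸ m → m ≤ val (opposite i)
val≤⇒≤val-opposite i = 1+≤2+∸⇒≤1+ (trans (+-comm (toℕ (opposite i)) (toℕ i)) (toℕ+toℕ-opposite i))

module _ {n : ℕ} (m : ℕ) where

  Cond1⇒Cond2-inverse : ∀ (π : Vec (Fin (suc n)) (suc n)) → Av321 π → Cond1 m π → Cond2 m (inverse π)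
  Cond1⇒Cond2-inverse π (perm , _) (i , πi≡1 , m≤i) =
    subst (λ j → m ≤ val j) (sym (trans (cong (lookup (inverse π)) (sym πi≡1)) (inverse∘lookup π perm i))) m≤i

  Cond2⇒Cond1-inverse : ∀ (π : Vec (Fin (suc n)) (suc n)) → Av321 π → Cond2 m π → Cond1 m (inverse π)
  Cond2⇒Cond1-inverse π (perm , _) m≤π1 = lookup π fz , inverse∘lookup π perm fz , m≤π1

  Cond1⇒Cond3-reverseComplement : ∀ (π : Vec (Fin (suc n)) (suc n)) → Cond1 m π → Cond3 m (reverseComplement π)
  Cond1⇒Cond3-reverseComplement π (i , πi≡1 , m≤i) =
    opposite i , trans (lookup-reverseComplement-opposite π i) (cong opposite πi≡1) , ≤val⇒val-opposite≤ i m≤i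

  Cond3⇒Cond1-reverseComplement : ∀ (π : Vec (Fin (suc n)) (suc n)) → Cond3 m π → Cond1 m (reverseComplement π)
  Cond3⇒Cond1-reverseComplement π (i , πi≡n , i≤) =
    opposite i ,
    trans (lookup-reverseComplement-opposite π i) (trans (cong opposite πi≡n) (Fin.opposite-involutive fz)) ,
    val≤⇒≤val-opposite i i≤

  Cond2⇒Cond4-reverseComplement : ∀ (π : Vec (Fin (suc n)) (suc n)) → Cond2 m π → Cond4 m (reverseComplement π)
  Cond2⇒Cond4-reverseComplement π m≤π1 =
    subst (λ j → val j ≤ suc (suc n) ∸ m) (sym (lookup-reverseComplement-opposite π fz))
          (≤val⇒val-opposite≤ (lookup π fz) m≤π1)

  Cond4⇒Cond2-reverseComplement : ∀ (π : Vec (Fin (suc n)) (suc n)) → Cond4 m π → Cond2 m (reverseComplement π)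
  Cond4⇒Cond2-reverseComplement π πn≤ =
    subst (λ j → m ≤ val j) (sym (lookup-reverseComplement π fz)) (val≤⇒≤val-opposite (lookup π (fromℕ n)) πn≤)

lemma13 : (n' m : ℕ) → 1 ≤ m → m ≤ suc n' →
    (count321 (suc n') (Cond1 m) (cond1? m) ≡ catK (suc m) (suc n' ∸ m)) ×
    (count321 (suc n') (Cond2 m) (cond2? m) ≡ catK (suc m) (suc n' ∸ m)) ×
    (count321 (suc n') (Cond3 m) (cond3? m) ≡ catK (suc m) (suc n' ∸ m)) ×
    (count321 (suc n') (Cond4 m) (cond4? m) ≡ catK (suc m) (suc n' ∸ m))
lemma13 n' m _ m≤n = count1 , count2 , count3 , count4
  where
  Counted : (P : Vec (Fin (suc n')) (suc n') → Set) → Decidable P → Set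
  Counted P P? = count321 (suc n') P P? ≡ catK (suc m) (suc n' ∸ m)
  count2 : Counted (Cond2 m) (cond2? m)
  count2 = begin
    count321 (suc n') (Cond2 m) (cond2? m) ≡⟨ count321-Cond2 n' m ⟩
    labelsAtLeast (suc n') m               ≡⟨ labelsAtLeast≡Ballot (suc n') m (suc n' ∸ m) (m+[n∸m]≡n m≤n) ⟩
    Ballot (suc m) (suc n' ∸ m)            ≡⟨ Ballot≡catK m (suc n' ∸ m) ⟩
    catK (suc m) (suc n' ∸ m)              ∎
    where open ≡-Reasoning
  count1 : Counted (Cond1 m) (cond1? m)
  count1 = trans (count321-involution (inverse {suc n'}) inverse-Av321 (λ π (perm , _) → inverse-involutive π perm)
                   (cond1? m) (cond2? m) (Cond1⇒Cond2-inverse m) (Cond2⇒Cond1-inverse m))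
                 count2
  count3 : Counted (Cond3 m) (cond3? m)
  count3 = trans (count321-involution (reverseComplement {suc n'}) reverseComplement-Av321 (λ π _ → reverseComplement-involutive π)
                   (cond3? m) (cond1? m) (λ π _ → Cond3⇒Cond1-reverseComplement m π) (λ π _ → Cond1⇒Cond3-reverseComplement m π))
                 count1
  count4 : Counted (Cond4 m) (cond4? m)
  count4 = trans (count321-involution (reverseComplement {suc n'}) reverseComplement-Av321 (λ π _ → reverseComplement-involutive π)
                   (cond4? m) (cond2? m) (λ π _ → Cond4⇒Cond2-reverseComplement m π) (λ π _ → Cond2⇒Cond4-reverseComplement m π))
                 count2
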